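{- For each positive integer $k$ there exists a finite set $A\subset\mathbb{Z}^2$ such that $|cA+cA|>|cA-cA|$ for all $1\leq c\leq k$.
   Context: For a finite set $A\subset\mathbb{Z}^2$ and a positive integer $c$, $cA=\{a_1+\cdots+a_c:a_i\in A\}$ is the $c$-fold sumset; $cA+cA$ and $cA-cA$ are the sumset and difference set of $cA$. -}

module Defs where

open import Data.Nat using (ℕ; zero; suc)
open import Data.Integer as ℤ using (ℤ)
open import Data.Product using (_×_; _,_)
open import Data.Product.Properties using (≡-dec)
open import Data.List using (List; []; _∷_; length; deduplicate; cartesianProductWith)
open import Relation.Binary.Definitions using (DecidableEquality)

ℤ² : Set
ℤ² = ℤ × ℤ

_≟²_ : DecidableEquality ℤ²
_≟²_ = ≡-dec ℤ._≟_ ℤ._≟_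

_+²_ : ℤ² → ℤ² → ℤ²
(a , b) +² (c , d) = (a ℤ.+ c , b ℤ.+ d)

_-²_ : ℤ² → ℤ² → ℤ²
(a , b) -² (c , d) = (a ℤ.- c , b ℤ.- d)

-- Finite sets of ℤ² are represented by lists (duplicates allowed; only
-- membership matters).  Cardinality = number of distinct elements.
∣_∣ : List ℤ² → ℕ
∣ X ∣ = length (deduplicate _≟²_ X)

_⊕_ : List ℤ² → List ℤ² → List ℤ²
X ⊕ Y = cartesianProductWith _+²_ X Y

_⊖_ : List ℤ² → List ℤ² → List ℤ²
X ⊖ Y = cartesianProductWith _-²_ X Y

-- The 0-fold sumset is {0}; the (c+1)-fold sumset is A + cA.
-- So for c ≥ 1, c·A = {a₁ + ⋯ + a_c : aᵢ ∈ A}.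
_·_ : ℕ → List ℤ² → List ℤ²
zero · A = (ℤ.0ℤ , ℤ.0ℤ) ∷ []
suc c · A = A ⊕ (c · A)

module Submission where

-- With n = 2T, A is the set of lattice points of [0, n]² whose coordinate sum lies in
-- {0, 1} ∪ [T, 2n − T] ∪ {2n}.  By induction on c, cA is the set of points of [0, cn]² with
-- coordinate sum in [0, c] ∪ [T, 2cn − T] ∪ {2cn}: admissible sums add up, and a point of the
-- middle band splits off one of (0,0), (T,0), (n,0), (n,n), (n,T) from A.
-- Let 2c < T.  Translating cA − cA by (cn, cn) lands in 2cA = cA + cA, except for the points
-- (2cn − x, 2cn − y) with x + y ≤ c, which come from (cn, cn) − cA: the sums [0, c] of cA are
-- not mirrored at the top.  These are moved to (c + 1 − x, c − y), or to (0, c + 1) when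
-- x = y = 0, whose coordinate sums lie in (c, 2c] and are used by no other translated
-- difference.  The resulting injection of cA − cA into cA + cA misses (2cn, 2cn).

open import Data.Empty using (⊥-elim)
open import Data.Integer as ℤ using (ℤ)
import Data.Integer.Properties as ℤ
import Data.Integer.Tactic.RingSolver as ℤ-Solver
open import Data.List using (List; []; _∷_; _++_; length; deduplicate; map; filter; cartesianProduct; upTo)
open import Data.List.Membership.Propositional using (_∈_; mapWith∈)
open import Data.List.Membership.Propositional.Properties
  using (∈-∃++; ∈-++⁻; ∈-++⁺ˡ; ∈-++⁺ʳ; ∈-deduplicate⁺; ∈-deduplicate⁻;
         ∈-cartesianProductWith⁺; ∈-cartesianProductWith⁻; ∈-cartesianProduct⁺; ∈-cartesianProduct⁻;
         ∈-map∘filter⁺; ∈-map∘filter⁻; ∈-upTo⁺; ∈-upTo⁻)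
open import Data.List.Membership.Setoid.Properties using (length-mapWith∈)
open import Data.List.Relation.Binary.Permutation.Propositional.Properties using (↭-length) renaming (shift to ↭-shift)
open import Data.List.Relation.Binary.Subset.Propositional using (_⊆_)
import Data.List.Relation.Unary.All as All
open import Data.List.Relation.Unary.AllPairs using (_∷_)
open import Data.List.Relation.Unary.Any using (here; there)
open import Data.List.Relation.Unary.Any.Properties using (mapWith∈⁻)
open import Data.List.Relation.Unary.Unique.DecPropositional.Properties using (deduplicate-!)
open import Data.List.Relation.Unary.Unique.Propositional using (Unique; [])
open import Data.Nat as ℕ using (ℕ; zero; suc; _+_; _*_; _∸_; _≤_; _<_; z≤n; s≤s; s≤s⁻¹; _≤?_; _<?_)
open import Data.Nat.Properties
open import Data.Nat.Tactic.RingSolver using (solve-∀)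
open import Data.Product using (Σ-syntax; _×_; _,_; proj₁; proj₂; uncurry)
open import Data.Sum using (_⊎_; inj₁; inj₂)
open import Function using (_∘_; case_of_)
open import Relation.Binary.PropositionalEquality
open import Relation.Nullary using (¬_; Dec; yes; no)
open import Relation.Nullary.Decidable using (_⊎-dec_; _×-dec_)

open import Defs
open import Algebra.Properties.AbelianGroup ℤ.+-0-abelianGroup using (∙-cancelʳ)
open import Algebra.Properties.CommutativeSemigroup +-commutativeSemigroup using (interchange; xy∙z≈xz∙y; xy∙z≈y∙zx)

private variable V W : Set

Unique⇒length-mono-⊆ : {xs ys : List V} → Unique xs → xs ⊆ ys → length xs ≤ length ys
Unique⇒length-mono-⊆ [] _ = z≤n
Unique⇒length-mono-⊆ {xs = x ∷ xs} (x∉xs ∷ xs!) xs⊆ys with ∈-∃++ (xs⊆ys (here refl))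
... | us , vs , refl = subst (suc (length xs) ≤_) (sym (↭-length (↭-shift x us vs)))
                         (s≤s (Unique⇒length-mono-⊆ xs! drop-x))
  where
  drop-x : xs ⊆ us ++ vs
  drop-x {y} y∈xs with ∈-++⁻ us (xs⊆ys (there y∈xs))
  ... | inj₁ y∈us = ∈-++⁺ˡ y∈us
  ... | inj₂ (here refl) = ⊥-elim (All.lookup x∉xs y∈xs refl)
  ... | inj₂ (there y∈vs) = ∈-++⁺ʳ us y∈vs

mapWith∈-Unique : {xs : List V} (f : ∀ {x} → x ∈ xs → W) →
                  (∀ {x y} (p : x ∈ xs) (q : y ∈ xs) → f p ≡ f q → x ≡ y) →
                  Unique xs → Unique (mapWith∈ xs f)
mapWith∈-Unique f f-inj [] = []
mapWith∈-Unique {xs = x ∷ xs} f f-inj (x∉xs ∷ xs!) =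
  All.tabulate fx∉ ∷ mapWith∈-Unique (f ∘ there) (λ p q → f-inj (there p) (there q)) xs!
  where
  fx∉ : ∀ {w} → w ∈ mapWith∈ xs (f ∘ there) → f (here refl) ≢ w
  fx∉ w∈ fx≡w with mapWith∈⁻ xs (f ∘ there) w∈
  ... | y , y∈xs , refl = All.lookup x∉xs y∈xs (f-inj (here refl) (there y∈xs) fx≡w)

∣∣<∣∣-by-injection : {xs ys : List ℤ²} (f : ∀ {x} → x ∈ xs → ℤ²) →
                     (∀ {x y} (p : x ∈ xs) (q : y ∈ xs) → f p ≡ f q → x ≡ y) →
                     (∀ {x} (p : x ∈ xs) → f p ∈ ys) →
                     (y₀ : ℤ²) → y₀ ∈ ys → (∀ {x} (p : x ∈ xs) → f p ≢ y₀) →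
                     ∣ xs ∣ < ∣ ys ∣
∣∣<∣∣-by-injection {xs} {ys} f f-inj f∈ys y₀ y₀∈ys y₀∉f =
  subst (_≤ ∣ ys ∣) (cong suc (length-mapWith∈ (setoid ℤ²) xs′ {f = g}))
        (Unique⇒length-mono-⊆ (y₀∉ ∷ mapWith∈-Unique g g-inj (deduplicate-! _≟²_ xs)) image⊆)
  where
  xs′ : List ℤ²
  xs′ = deduplicate _≟²_ xs
  from-dedup : ∀ {x} → x ∈ xs′ → x ∈ xs
  from-dedup = ∈-deduplicate⁻ _≟²_ xs
  g : ∀ {x} → x ∈ xs′ → ℤ²
  g = f ∘ from-dedup
  g-inj : ∀ {x y} (p : x ∈ xs′) (q : y ∈ xs′) → g p ≡ g q → x ≡ y
  g-inj p q = f-inj (from-dedup p) (from-dedup q)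
  y₀∉ : All.All (y₀ ≢_) (mapWith∈ xs′ g)
  y₀∉ = All.tabulate y₀∉image
    where
    y₀∉image : ∀ {w} → w ∈ mapWith∈ xs′ g → y₀ ≢ w
    y₀∉image w∈ y₀≡w with mapWith∈⁻ xs′ g w∈
    ... | _ , p , refl = y₀∉f (from-dedup p) (sym y₀≡w)
  image⊆ : y₀ ∷ mapWith∈ xs′ g ⊆ deduplicate _≟²_ ys
  image⊆ (here refl) = ∈-deduplicate⁺ _≟²_ y₀∈ys
  image⊆ (there w∈) with mapWith∈⁻ xs′ g w∈
  ... | _ , p , refl = ∈-deduplicate⁺ _≟²_ (f∈ys (from-dedup p))

⟪_,_⟫ : ℕ → ℕ → ℤ²
⟪ x , y ⟫ = (ℤ.+ x , ℤ.+ y)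

+²-identityˡ : ∀ w → ⟪ 0 , 0 ⟫ +² w ≡ w
+²-identityˡ (u , v) = cong₂ _,_ (ℤ.+-identityˡ u) (ℤ.+-identityˡ v)

+²-cancelʳ : ∀ {u v} w → u +² w ≡ v +² w → u ≡ v
+²-cancelʳ {u₁ , u₂} {v₁ , v₂} (w₁ , w₂) eq =
  cong₂ _,_ (∙-cancelʳ w₁ u₁ v₁ (cong proj₁ eq)) (∙-cancelʳ w₂ u₂ v₂ (cong proj₂ eq))

⟪⟫-injective : ∀ {x y x′ y′} → ⟪ x , y ⟫ ≡ ⟪ x′ , y′ ⟫ → x ≡ x′ × y ≡ y′
⟪⟫-injective refl = refl , refl

+²-assoc : ∀ u v w → (u +² v) +² w ≡ u +² (v +² w)
+²-assoc (u₁ , u₂) (v₁ , v₂) (w₁ , w₂) = cong₂ _,_ (ℤ.+-assoc u₁ v₁ w₁) (ℤ.+-assoc u₂ v₂ w₂)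

module _ {A : List ℤ²} where

  ∈-·-suc⁺ : ∀ m {a z} → a ∈ A → z ∈ m · A → a +² z ∈ suc m · A
  ∈-·-suc⁺ m = ∈-cartesianProductWith⁺ _+²_

  ∈-·-suc⁻ : ∀ m {w} → w ∈ suc m · A → Σ[ a ∈ ℤ² ] Σ[ z ∈ ℤ² ] (a ∈ A × z ∈ m · A × w ≡ a +² z)
  ∈-·-suc⁻ m = ∈-cartesianProductWith⁻ _+²_ A (m · A)

  ∈-·-+⁻ : ∀ m m′ {w} → w ∈ (m + m′) · A → w ∈ (m · A) ⊕ (m′ · A)
  ∈-·-+⁻ zero m′ {w} w∈ =
    subst (_∈ _) (+²-identityˡ w) (∈-cartesianProductWith⁺ _+²_ {xs = 0 · A} (here refl) w∈)
  ∈-·-+⁻ (suc m) m′ w∈ with ∈-·-suc⁻ (m + m′) w∈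
  ... | a , z , a∈ , z∈ , refl with ∈-cartesianProductWith⁻ _+²_ (m · A) (m′ · A) (∈-·-+⁻ m m′ z∈)
  ... | p , q , p∈ , q∈ , refl =
    subst (_∈ _) (+²-assoc a p q) (∈-cartesianProductWith⁺ _+²_ (∈-·-suc⁺ m a∈ p∈) q∈)

x+y≡m+m⇒x≡m×y≡m : ∀ {m x y} → x ≤ m → y ≤ m → x + y ≡ m + m → x ≡ m × y ≡ m
x+y≡m+m⇒x≡m×y≡m {m} {x} {y} x≤m y≤m x+y≡m+m =
  ≤-antisym x≤m (+-cancelʳ-≤ y m x (subst (m + y ≤_) (sym x+y≡m+m) (+-monoʳ-≤ m y≤m))) ,
  ≤-antisym y≤m (+-cancelˡ-≤ x m y (subst (x + m ≤_) (sym x+y≡m+m) (+-monoˡ-≤ m x≤m)))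

module Construction (T : ℕ) (1≤T : 1 ≤ T) where

  open ≤-Reasoning

  n : ℕ
  n = T + T

  T≤n : T ≤ n
  T≤n = m≤m+n T T

  1≤n : 1 ≤ n
  1≤n = ≤-trans 1≤T T≤n

  c≤c*n : ∀ c → c ≤ c * n
  c≤c*n c = subst (_≤ c * n) (*-identityʳ c) (*-monoʳ-≤ c 1≤n)

  n≤c*n : ∀ {c} → 1 ≤ c → n ≤ c * n
  n≤c*n {suc c} _ = m≤m+n n (c * n)

  top : ℕ → ℕ
  top c = c * n + c * n

  top-+ : ∀ a b → top (a + b) ≡ top a + top b
  top-+ a b = distrib a b n
    where
    distrib : ∀ a b n → (a + b) * n + (a + b) * n ≡ (a * n + a * n) + (b * n + b * n)
    distrib = solve-∀

  MiddleSum : ℕ → ℕ → Set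
  MiddleSum c s = T ≤ s × s + T ≤ top c

  GoodSum : ℕ → ℕ → Set
  GoodSum c s = s ≤ c ⊎ MiddleSum c s ⊎ s ≡ top c

  goodSum? : ∀ c s → Dec (GoodSum c s)
  goodSum? c s = (s ≤? c) ⊎-dec ((T ≤? s) ×-dec (s + T ≤? top c)) ⊎-dec (s ℕ.≟ top c)

  data Region (c : ℕ) : ℤ² → Set where
    region : ∀ {x y} → x ≤ c * n → y ≤ c * n → GoodSum c (x + y) → Region c ⟪ x , y ⟫

  GoodSum-middle : ∀ a b {u} → T ≤ u → u + T ≤ top a + top b → GoodSum (a + b) u
  GoodSum-middle a b {u} T≤u u+T≤ = inj₂ (inj₁ (T≤u , subst (u + T ≤_) (sym (top-+ a b)) u+T≤))

  GoodSum-+-low : ∀ {a b s t} → s ≤ a → GoodSum b t → GoodSum (a + b) (s + t)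
  GoodSum-+-low s≤a (inj₁ t≤b) = inj₁ (+-mono-≤ s≤a t≤b)
  GoodSum-+-low {a} {b} {s} {t} s≤a (inj₂ (inj₁ (T≤t , t+T≤))) = GoodSum-middle a b (≤-trans T≤t (m≤n+m t s)) (begin
    s + t + T   ≡⟨ +-assoc s t T ⟩
    s + (t + T) ≤⟨ +-mono-≤ (≤-trans s≤a (≤-trans (c≤c*n a) (m≤m+n _ _))) t+T≤ ⟩
    top a + top b ∎)
  GoodSum-+-low {a} {zero} s≤a (inj₂ (inj₂ refl)) = inj₁ (+-monoˡ-≤ 0 s≤a)
  GoodSum-+-low {zero} {suc b} z≤n (inj₂ (inj₂ refl)) = inj₂ (inj₂ refl)
  GoodSum-+-low {suc a} {suc b} {s} s≤a (inj₂ (inj₂ refl)) = GoodSum-middle (suc a) (suc b)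
    (≤-trans (T≤c*n {b}) (≤-trans (m≤m+n _ _) (m≤n+m _ s))) (begin
      s + top (suc b) + T   ≡⟨ xy∙z≈xz∙y s (top (suc b)) T ⟩
      s + T + top (suc b)   ≤⟨ +-monoˡ-≤ (top (suc b)) (+-mono-≤ (≤-trans s≤a (c≤c*n (suc a))) (T≤c*n {a})) ⟩
      top (suc a) + top (suc b) ∎)
    where
    T≤c*n : ∀ {c} → T ≤ suc c * n
    T≤c*n {c} = ≤-trans T≤n (n≤c*n {suc c} (s≤s z≤n))

  GoodSum-+-middle : ∀ {a b s t} → MiddleSum a s → MiddleSum b t ⊎ t ≡ top b → GoodSum (a + b) (s + t)
  GoodSum-+-middle {a} {b} {s} {t} (T≤s , s+T≤) t-high = GoodSum-middle a b (≤-trans T≤s (m≤m+n s t)) (begin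
    s + t + T   ≡⟨ xy∙z≈xz∙y s t T ⟩
    s + T + t   ≤⟨ +-mono-≤ s+T≤ t≤top ⟩
    top a + top b ∎)
    where
    t≤top : t ≤ top b
    t≤top = case t-high of λ where
      (inj₁ (_ , t+T≤)) → m+n≤o⇒m≤o t t+T≤
      (inj₂ refl)        → ≤-refl

  GoodSum-+ : ∀ {a b s t} → GoodSum a s → GoodSum b t → GoodSum (a + b) (s + t)
  GoodSum-+ {a} {b} (inj₁ s≤a) gt = GoodSum-+-low {a} {b} s≤a gt
  GoodSum-+ {a} {b} {s} {t} gs (inj₁ t≤b) =
    subst₂ GoodSum (+-comm b a) (+-comm t s) (GoodSum-+-low {b} {a} t≤b gs)
  GoodSum-+ {a} {b} (inj₂ (inj₁ ms)) (inj₂ gt) = GoodSum-+-middle {a} {b} ms gt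
  GoodSum-+ {a} {b} {s} {t} (inj₂ (inj₂ s≡)) (inj₂ (inj₁ mt)) =
    subst₂ GoodSum (+-comm b a) (+-comm t s) (GoodSum-+-middle {b} {a} mt (inj₂ s≡))
  GoodSum-+ {a} {b} (inj₂ (inj₂ refl)) (inj₂ (inj₂ refl)) = inj₂ (inj₂ (sym (top-+ a b)))

  Region-+ : ∀ {a b u v} → Region a u → Region b v → Region (a + b) (u +² v)
  Region-+ {a} {b} (region {x} {y} x≤ y≤ gs) (region {x′} {y′} x′≤ y′≤ gt) =
    region (box x≤ x′≤) (box y≤ y′≤) (subst (GoodSum (a + b)) (interchange x y x′ y′) (GoodSum-+ gs gt))
    where
    box : ∀ {p q} → p ≤ a * n → q ≤ b * n → p + q ≤ (a + b) * n
    box {p} {q} p≤ q≤ = subst (p + q ≤_) (sym (*-distribʳ-+ n a b)) (+-mono-≤ p≤ q≤)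

  -- The bound is written 1 * n rather than n so that membership in A is literally Region 1.
  [0,n] : List ℕ
  [0,n] = upTo (suc (1 * n))

  good₁? : ∀ ((x , y) : ℕ × ℕ) → Dec (GoodSum 1 (x + y))
  good₁? (x , y) = goodSum? 1 (x + y)

  A : List ℤ²
  A = map (uncurry ⟪_,_⟫) (filter good₁? (cartesianProduct [0,n] [0,n]))

  ∈A⁺ : ∀ {z} → Region 1 z → z ∈ A
  ∈A⁺ (region {x} {y} x≤ y≤ g) =
    ∈-map∘filter⁺ (uncurry ⟪_,_⟫) good₁? {f = uncurry ⟪_,_⟫}
      ((x , y) , ∈-cartesianProduct⁺ (∈-upTo⁺ (s≤s x≤)) (∈-upTo⁺ (s≤s y≤)) , refl , g)

  ∈A⁻ : ∀ {z} → z ∈ A → Region 1 z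
  ∈A⁻ z∈ with ∈-map∘filter⁻ (uncurry ⟪_,_⟫) good₁? {f = uncurry ⟪_,_⟫} {xs = cartesianProduct [0,n] [0,n]} z∈
  ... | (x , y) , xy∈ , refl , g with ∈-cartesianProduct⁻ _ _ xy∈
  ... | x∈ , y∈ = region (s≤s⁻¹ (∈-upTo⁻ x∈)) (s≤s⁻¹ (∈-upTo⁻ y∈)) g

  ·A⊆Region : ∀ c {z} → z ∈ c · A → Region c z
  ·A⊆Region zero (here refl) = region z≤n z≤n (inj₁ z≤n)
  ·A⊆Region (suc c) z∈ with ∈-·-suc⁻ c z∈
  ... | a , z , a∈ , z∈ , refl = Region-+ (∈A⁻ a∈) (·A⊆Region c z∈)

  ⟪⟫∈A : ∀ {x y} → x ≤ n → y ≤ n → GoodSum 1 (x + y) → ⟪ x , y ⟫ ∈ A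
  ⟪⟫∈A x≤n y≤n g = ∈A⁺ (region (≤1*n x≤n) (≤1*n y≤n) g)
    where
    ≤1*n : ∀ {x} → x ≤ n → x ≤ 1 * n
    ≤1*n {x} = subst (x ≤_) (sym (*-identityˡ n))

  top1≡n+n : top 1 ≡ n + n
  top1≡n+n = cong₂ _+_ (*-identityˡ n) (*-identityˡ n)

  middle₁ : ∀ {s} → T ≤ s → s + T ≤ n + n → GoodSum 1 s
  middle₁ {s} T≤s s+T≤ = inj₂ (inj₁ (T≤s , subst (s + T ≤_) (sym top1≡n+n) s+T≤))

  top₁ : GoodSum 1 (n + n)
  top₁ = inj₂ (inj₂ (sym top1≡n+n))

  swap² : ℤ² → ℤ²
  swap² (u , v) = (v , u)

  Region-swap : ∀ {c z} → Region c z → Region c (swap² z)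
  Region-swap {c} (region {x} {y} x≤ y≤ g) = region y≤ x≤ (subst (GoodSum c) (+-comm x y) g)

  ·A-swap : ∀ c {z} → z ∈ c · A → swap² z ∈ c · A
  ·A-swap zero (here refl) = here refl
  ·A-swap (suc c) z∈ with ∈-·-suc⁻ c z∈
  ... | a , z , a∈ , z∈ , refl = ∈-·-suc⁺ c (∈A⁺ (Region-swap (∈A⁻ a∈))) (·A-swap c z∈)

  small∈· : ∀ m {x y} → x + y ≤ m → ⟪ x , y ⟫ ∈ m · A
  small∈· zero {zero} {zero} _ = here refl
  small∈· (suc m) {suc x} (s≤s x+y≤m) = ∈-·-suc⁺ m (⟪⟫∈A 1≤n z≤n (inj₁ ≤-refl)) (small∈· m x+y≤m)
  small∈· (suc m) {zero} {suc y} (s≤s y≤m) = ∈-·-suc⁺ m (⟪⟫∈A z≤n 1≤n (inj₁ ≤-refl)) (small∈· m y≤m)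
  small∈· (suc m) {zero} {zero} _ = ∈-·-suc⁺ m (⟪⟫∈A z≤n z≤n (inj₁ z≤n)) (small∈· m z≤n)

  top∈· : ∀ m → ⟪ m * n , m * n ⟫ ∈ m · A
  top∈· zero = here refl
  top∈· (suc m) = ∈-·-suc⁺ m (⟪⟫∈A ≤-refl ≤-refl top₁) (top∈· m)

  module Peeling (c : ℕ)
    (ih : ∀ {x y} → x ≤ suc c * n → y ≤ suc c * n → MiddleSum (suc c) (x + y) → ⟪ x , y ⟫ ∈ suc c · A)
    where

    L : ℕ
    L = suc c * n

    n≤L : n ≤ L
    n≤L = n≤c*n {suc c} (s≤s z≤n)

    T≤L : T ≤ L
    T≤L = ≤-trans T≤n n≤L

    peel : ∀ {X Y} p q → p ≤ n → q ≤ n → GoodSum 1 (p + q) → p ≤ X → q ≤ Y → X ≤ p + L → Y ≤ q + L →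
           T + (p + q) ≤ X + Y → X + Y + T ≤ L + L + (p + q) → ⟪ X , Y ⟫ ∈ suc (suc c) · A
    peel {X} {Y} p q p≤n q≤n g p≤X q≤Y X≤ Y≤ lo hi =
      subst (_∈ suc (suc c) · A) (cong₂ ⟪_,_⟫ (m+[n∸m]≡n p≤X) (m+[n∸m]≡n q≤Y))
        (∈-·-suc⁺ (suc c) (⟪⟫∈A p≤n q≤n g)
          (ih (m≤n+o⇒m∸n≤o X p X≤) (m≤n+o⇒m∸n≤o Y q Y≤) (rest-lo , rest-hi)))
      where
      X′ Y′ : ℕ
      X′ = X ∸ p
      Y′ = Y ∸ q
      split : X′ + Y′ + (p + q) ≡ X + Y
      split = trans (interchange X′ Y′ p q)
                (trans (cong₂ _+_ (+-comm X′ p) (+-comm Y′ q)) (cong₂ _+_ (m+[n∸m]≡n p≤X) (m+[n∸m]≡n q≤Y)))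
      rest-lo : T ≤ X′ + Y′
      rest-lo = +-cancelʳ-≤ (p + q) T (X′ + Y′) (subst (T + (p + q) ≤_) (sym split) lo)
      rest-hi : X′ + Y′ + T ≤ L + L
      rest-hi = +-cancelʳ-≤ (p + q) (X′ + Y′ + T) (L + L)
        (subst (_≤ L + L + (p + q)) (trans (cong (_+ T) (sym split)) (xy∙z≈xz∙y (X′ + Y′) (p + q) T)) hi)

    peel-0,0 : ∀ {X Y} → X ≤ L → Y ≤ L → T ≤ X + Y → X + Y + T ≤ L + L → ⟪ X , Y ⟫ ∈ suc (suc c) · A
    peel-0,0 {X} {Y} X≤L Y≤L lo hi = peel 0 0 z≤n z≤n (inj₁ z≤n) z≤n z≤n X≤L Y≤L
      (subst (_≤ X + Y) (sym (+-identityʳ T)) lo) (subst (X + Y + T ≤_) (sym (+-identityʳ (L + L))) hi)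

    peel-T,0 : ∀ {X Y} → T ≤ X → X ≤ T + L → Y ≤ L → T + T ≤ X + Y → X + Y ≤ L + L →
               ⟪ X , Y ⟫ ∈ suc (suc c) · A
    peel-T,0 {X} {Y} T≤X X≤ Y≤L lo hi = peel T 0 T≤n z≤n good T≤X z≤n X≤ Y≤L
      (subst (_≤ X + Y) (cong (T +_) (sym (+-identityʳ T))) lo)
      (subst (X + Y + T ≤_) (cong (L + L +_) (sym (+-identityʳ T))) (+-monoˡ-≤ T hi))
      where
      good : GoodSum 1 (T + 0)
      good = middle₁ (m≤m+n T 0) (subst (λ t → t + T ≤ n + n) (sym (+-identityʳ T)) (m≤m+n n n))

    peel-n,0 : ∀ {X Y} → n ≤ X → X ≤ n + L → Y ≤ n → n + T ≤ X + Y → X + Y + T ≤ L + L + n →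
               ⟪ X , Y ⟫ ∈ suc (suc c) · A
    peel-n,0 {X} {Y} n≤X X≤ Y≤n lo hi = peel n 0 ≤-refl z≤n good n≤X z≤n X≤ (≤-trans Y≤n n≤L)
      (subst (_≤ X + Y) (trans (+-comm n T) (cong (T +_) (sym (+-identityʳ n)))) lo)
      (subst (X + Y + T ≤_) (cong (L + L +_) (sym (+-identityʳ n))) hi)
      where
      good : GoodSum 1 (n + 0)
      good = middle₁ (≤-trans T≤n (m≤m+n n 0))
                     (subst (λ m → m + T ≤ n + n) (sym (+-identityʳ n)) (+-monoʳ-≤ n T≤n))

    peel-n,n : ∀ {X Y} → n ≤ X → n ≤ Y → X ≤ n + L → Y ≤ n + L → n + n + T ≤ X + Y →
               X + Y + T ≤ (n + L) + (n + L) → ⟪ X , Y ⟫ ∈ suc (suc c) · A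
    peel-n,n {X} {Y} n≤X n≤Y X≤ Y≤ lo hi = peel n n ≤-refl ≤-refl top₁ n≤X n≤Y X≤ Y≤
      (subst (_≤ X + Y) (+-comm (n + n) T) lo)
      (subst (X + Y + T ≤_) (trans (interchange n L n L) (+-comm (n + n) (L + L))) hi)

    peel-n,T : ∀ {X Y} → n ≤ X → T ≤ Y → X ≤ n + L → Y ≤ T + L → n + n ≤ X + Y → X + Y ≤ L + L + n →
               ⟪ X , Y ⟫ ∈ suc (suc c) · A
    peel-n,T {X} {Y} n≤X T≤Y X≤ Y≤ lo hi = peel n T ≤-refl T≤n good n≤X T≤Y X≤ Y≤
      (subst (_≤ X + Y) (three T) lo)
      (subst (X + Y + T ≤_) (+-assoc (L + L) n T) (+-monoˡ-≤ T hi))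
      where
      three : ∀ t → (t + t) + (t + t) ≡ t + ((t + t) + t)
      three = solve-∀
      good : GoodSum 1 (n + T)
      good = middle₁ (m≤n+m T n) (≤-reflexive (+-assoc n T T))

    middle-low : ∀ {X Y} → X ≤ L → Y ≤ L → T ≤ X + Y → ⟪ X , Y ⟫ ∈ suc (suc c) · A
    middle-low {X} {Y} X≤L Y≤L lo with X + Y + T ≤? L + L
    ... | yes hi = peel-0,0 X≤L Y≤L lo hi
    ... | no ¬hi = peel-T,0 T≤X (m≤n⇒m≤o+n T X≤L) Y≤L lo′ (+-mono-≤ X≤L Y≤L)
      where
      T≤X : T ≤ X
      T≤X = ≮⇒≥ λ X<T → ¬hi (begin
        X + Y + T   ≤⟨ +-monoˡ-≤ T (+-mono-≤ (<⇒≤ X<T) Y≤L) ⟩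
        T + L + T   ≡⟨ xy∙z≈xz∙y T L T ⟩
        T + T + L   ≤⟨ +-monoˡ-≤ L n≤L ⟩
        L + L       ∎)
      lo′ : T + T ≤ X + Y
      lo′ = +-cancelʳ-≤ T (T + T) (X + Y) (begin
        T + T + T   ≤⟨ +-mono-≤ n≤L T≤L ⟩
        L + L       ≤⟨ <⇒≤ (≰⇒> ¬hi) ⟩
        X + Y + T   ∎)

    module _ {X Y : ℕ} (L<X : L < X) (X≤ : X ≤ n + L) where

      n≤X : n ≤ X
      n≤X = ≤-trans n≤L (<⇒≤ L<X)

      middle-high-small-sum : X + Y < n + T → ⟪ X , Y ⟫ ∈ suc (suc c) · A
      middle-high-small-sum X+Y<n+T = peel-T,0 (≤-trans T≤L (<⇒≤ L<X)) X≤T+L Y≤L lo hi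
        where
        X+Y≤n+T : X + Y ≤ n + T
        X+Y≤n+T = <⇒≤ X+Y<n+T
        X≤T+L : X ≤ T + L
        X≤T+L = ≤-trans (m≤m+n X Y) (≤-trans X+Y≤n+T (≤-trans (+-monoˡ-≤ T n≤L) (≤-reflexive (+-comm L T))))
        Y≤L : Y ≤ L
        Y≤L = ≤-trans (+-cancelˡ-≤ L Y T (begin
          L + Y  ≤⟨ +-monoˡ-≤ Y (<⇒≤ L<X) ⟩
          X + Y  ≤⟨ X+Y≤n+T ⟩
          n + T  ≤⟨ +-monoˡ-≤ T n≤L ⟩
          L + T  ∎)) T≤L
        lo : T + T ≤ X + Y
        lo = ≤-trans n≤L (≤-trans (<⇒≤ L<X) (m≤m+n X Y))
        hi : X + Y ≤ L + L
        hi = ≤-trans X+Y≤n+T (+-mono-≤ n≤L T≤L)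

      middle-high-Y-large : n ≤ Y → Y ≤ n + L → X + Y + T ≤ (n + L) + (n + L) → ⟪ X , Y ⟫ ∈ suc (suc c) · A
      middle-high-Y-large n≤Y Y≤ hi with n + n + T ≤? X + Y
      ... | yes lo = peel-n,n n≤X n≤Y X≤ Y≤ lo hi
      ... | no ¬lo = peel-n,T n≤X (≤-trans T≤n n≤Y) X≤ Y≤T+L (+-mono-≤ n≤X n≤Y) hi′
        where
        X+Y≤ : X + Y ≤ n + n + T
        X+Y≤ = <⇒≤ (≰⇒> ¬lo)
        Y≤T+L : Y ≤ T + L
        Y≤T+L = +-cancelˡ-≤ L Y (T + L) (begin
          L + Y        ≤⟨ +-monoˡ-≤ Y (<⇒≤ L<X) ⟩
          X + Y        ≤⟨ X+Y≤ ⟩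
          n + n + T    ≤⟨ +-monoˡ-≤ T (+-mono-≤ n≤L n≤L) ⟩
          L + L + T    ≡⟨ xy∙z≈y∙zx L L T ⟩
          L + (T + L)  ∎)
        hi′ : X + Y ≤ L + L + n
        hi′ = begin
          X + Y        ≤⟨ X+Y≤ ⟩
          n + n + T    ≡⟨ xy∙z≈y∙zx n n T ⟩
          n + (T + n)  ≤⟨ +-monoʳ-≤ n (+-mono-≤ T≤L n≤L) ⟩
          n + (L + L)  ≡⟨ +-comm n (L + L) ⟩
          L + L + n    ∎

      middle-high-Y-small : Y < n → n + T ≤ X + Y → ⟪ X , Y ⟫ ∈ suc (suc c) · A
      middle-high-Y-small Y<n lo with X + Y + T ≤? L + L + n
      ... | yes hi = peel-n,0 n≤X X≤ (<⇒≤ Y<n) lo hi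
      ... | no ¬hi = peel-n,T n≤X T≤Y X≤ (≤-trans (<⇒≤ Y<n) (≤-trans n≤L (m≤n+m L T))) lo′ hi′
        where
        big : L + L + n < X + Y + T
        big = ≰⇒> ¬hi
        L<Y+T : L < Y + T
        L<Y+T = +-cancelˡ-< (n + L) L (Y + T) (begin-strict
          n + L + L    ≡⟨ xy∙z≈y∙zx n L L ⟩
          L + (L + n)  ≡⟨ +-assoc L L n ⟨
          L + L + n    <⟨ big ⟩
          X + Y + T    ≡⟨ +-assoc X Y T ⟩
          X + (Y + T)  ≤⟨ +-monoˡ-≤ (Y + T) X≤ ⟩
          n + L + (Y + T) ∎)
        T≤Y : T ≤ Y
        T≤Y = <⇒≤ (+-cancelʳ-< T T Y (≤-<-trans n≤L L<Y+T))
        lo′ : n + n ≤ X + Y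
        lo′ = +-cancelʳ-≤ T (n + n) (X + Y) (begin
          n + n + T    ≡⟨ xy∙z≈xz∙y n n T ⟩
          n + T + n    ≤⟨ +-monoˡ-≤ n (+-mono-≤ n≤L T≤L) ⟩
          L + L + n    ≤⟨ <⇒≤ big ⟩
          X + Y + T    ∎)
        hi′ : X + Y ≤ L + L + n
        hi′ = begin
          X + Y        ≤⟨ +-mono-≤ X≤ (<⇒≤ Y<n) ⟩
          n + L + n    ≤⟨ +-monoˡ-≤ n (+-monoˡ-≤ L n≤L) ⟩
          L + L + n    ∎

      middle-high : Y ≤ n + L → X + Y + T ≤ (n + L) + (n + L) → ⟪ X , Y ⟫ ∈ suc (suc c) · A
      middle-high Y≤ hi with X + Y <? n + T | n ≤? Y
      ... | yes X+Y<n+T | _       = middle-high-small-sum X+Y<n+T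
      ... | no X+Y≮n+T | yes n≤Y = middle-high-Y-large n≤Y Y≤ hi
      ... | no X+Y≮n+T | no n≰Y  = middle-high-Y-small (≰⇒> n≰Y) (≮⇒≥ X+Y≮n+T)

    middle-step : ∀ {X Y} → X ≤ n + L → Y ≤ n + L → MiddleSum (suc (suc c)) (X + Y) →
                  ⟪ X , Y ⟫ ∈ suc (suc c) · A
    middle-step {X} {Y} X≤ Y≤ (lo , hi) with X ≤? L | Y ≤? L
    ... | yes X≤L | yes Y≤L = middle-low X≤L Y≤L lo
    ... | no X≰L  | _       = middle-high (≰⇒> X≰L) X≤ Y≤ hi
    ... | yes _   | no Y≰L  =
      ·A-swap (suc (suc c)) (middle-high (≰⇒> Y≰L) Y≤ X≤ (subst (λ s → s + T ≤ top (suc (suc c))) (+-comm X Y) hi))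

  middle∈· : ∀ c {x y} → x ≤ suc c * n → y ≤ suc c * n → MiddleSum (suc c) (x + y) → ⟪ x , y ⟫ ∈ suc c · A
  middle∈· zero {x} {y} x≤ y≤ mid =
    subst (_∈ 1 · A) (cong₂ ⟪_,_⟫ (+-identityʳ x) (+-identityʳ y))
      (∈-·-suc⁺ 0 (∈A⁺ (region x≤ y≤ (inj₂ (inj₁ mid)))) (here refl))
  middle∈· (suc c) = Peeling.middle-step c (middle∈· c)

  Region⊆·A : ∀ c {z} → 1 ≤ c → Region c z → z ∈ c · A
  Region⊆·A c _ (region _ _ (inj₁ x+y≤c)) = small∈· c x+y≤c
  Region⊆·A (suc c) _ (region x≤ y≤ (inj₂ (inj₁ mid))) = middle∈· c x≤ y≤ mid
  Region⊆·A c _ (region x≤ y≤ (inj₂ (inj₂ x+y≡top))) with x+y≡m+m⇒x≡m×y≡m x≤ y≤ x+y≡top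
  ... | refl , refl = top∈· c

  module Injection (c : ℕ) (1≤c : 1 ≤ c) (c+c<T : c + c < T) where

    C : ℕ
    C = c * n

    T≤C : T ≤ C
    T≤C = ≤-trans T≤n (n≤c*n 1≤c)

    c<T : c < T
    c<T = ≤-<-trans (m≤m+n c c) c+c<T

    T≤top : T ≤ top c
    T≤top = ≤-trans T≤C (m≤m+n C C)

    Kept : ℕ → Set
    Kept σ = σ ≤ c ⊎ MiddleSum (c + c) σ

    kept-middle : ∀ {σ} → T ≤ σ → σ + T ≤ top c + top c → Kept σ
    kept-middle {σ} T≤σ σ+T≤ = inj₂ (T≤σ , subst (σ + T ≤_) (sym (top-+ c c)) σ+T≤)

    kept-from-small-s₂ : ∀ {σ s₁ s₂} → s₁ + T ≤ top c → s₂ ≤ c → σ + s₂ ≡ s₁ + top c → Kept σ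
    kept-from-small-s₂ {σ} {s₁} {s₂} s₁+T≤ s₂≤c eq = kept-middle T≤σ (begin
      σ + T             ≤⟨ +-monoˡ-≤ T (m≤m+n σ s₂) ⟩
      σ + s₂ + T        ≡⟨ cong (_+ T) eq ⟩
      s₁ + top c + T    ≡⟨ xy∙z≈xz∙y s₁ (top c) T ⟩
      s₁ + T + top c    ≤⟨ +-monoˡ-≤ (top c) s₁+T≤ ⟩
      top c + top c     ∎)
      where
      T≤σ : T ≤ σ
      T≤σ = +-cancelʳ-≤ s₂ T σ (begin
        T + s₂       ≤⟨ +-monoʳ-≤ T s₂≤c ⟩
        T + c        ≤⟨ +-mono-≤ T≤C (c≤c*n c) ⟩
        C + C        ≤⟨ m≤n+m (top c) s₁ ⟩
        s₁ + top c   ≡⟨ eq ⟨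
        σ + s₂       ∎)

    sum-of-difference : ∀ {σ s₁ s₂} → σ + s₂ ≡ s₁ + top c → s₁ ≤ top c → GoodSum c s₁ → GoodSum c s₂ →
                        Kept σ ⊎ (s₁ ≡ top c × s₂ ≤ c)
    sum-of-difference {σ} {s₁} eq _ g₁ (inj₂ (inj₂ refl)) with +-cancelʳ-≡ (top c) σ s₁ eq | g₁
    ... | refl | inj₁ σ≤c             = inj₁ (inj₁ σ≤c)
    ... | refl | inj₂ (inj₁ (T≤σ , σ+T≤)) = inj₁ (kept-middle T≤σ (≤-trans σ+T≤ (m≤m+n (top c) (top c))))
    ... | refl | inj₂ (inj₂ refl)     = inj₁ (kept-middle T≤top (+-monoʳ-≤ (top c) T≤top))
    sum-of-difference {σ} {s₁} {s₂} eq s₁≤ _ (inj₂ (inj₁ (T≤s₂ , s₂+T≤))) = inj₁ (kept-middle T≤σ (begin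
      σ + T        ≤⟨ +-monoʳ-≤ σ T≤s₂ ⟩
      σ + s₂       ≡⟨ eq ⟩
      s₁ + top c   ≤⟨ +-monoˡ-≤ (top c) s₁≤ ⟩
      top c + top c ∎))
      where
      T≤σ : T ≤ σ
      T≤σ = +-cancelˡ-≤ s₂ T σ (begin
        s₂ + T       ≤⟨ s₂+T≤ ⟩
        top c        ≤⟨ m≤n+m (top c) s₁ ⟩
        s₁ + top c   ≡⟨ trans (+-comm s₂ σ) eq ⟨
        s₂ + σ       ∎)
    sum-of-difference _ _ (inj₂ (inj₂ refl)) (inj₁ s₂≤c) = inj₂ (refl , s₂≤c)
    sum-of-difference eq _ (inj₁ s₁≤c) (inj₁ s₂≤c) =
      inj₁ (kept-from-small-s₂ (≤-trans (+-monoˡ-≤ T s₁≤c) (+-mono-≤ (c≤c*n c) T≤C)) s₂≤c eq)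
    sum-of-difference eq _ (inj₂ (inj₁ (_ , s₁+T≤))) (inj₁ s₂≤c) = inj₁ (kept-from-small-s₂ s₁+T≤ s₂≤c eq)

    data Shifted : ℕ → ℕ → Set where
      kept   : ∀ {a b} → a ≤ top c → b ≤ top c → Kept (a + b) → Shifted a b
      apex   : Shifted (top c) (top c)
      corner : ∀ x y → 1 ≤ x + y → x + y ≤ c → Shifted (top c ∸ x) (top c ∸ y)

    shifted-sum : ∀ {X₁ Y₁ X₂ Y₂} → X₂ ≤ X₁ + C → Y₂ ≤ Y₁ + C →
                  (X₁ + C ∸ X₂) + (Y₁ + C ∸ Y₂) + (X₂ + Y₂) ≡ (X₁ + Y₁) + top c
    shifted-sum {X₁} {Y₁} {X₂} {Y₂} X₂≤ Y₂≤ = begin-equality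
      (X₁ + C ∸ X₂) + (Y₁ + C ∸ Y₂) + (X₂ + Y₂)   ≡⟨ interchange (X₁ + C ∸ X₂) (Y₁ + C ∸ Y₂) X₂ Y₂ ⟩
      (X₁ + C ∸ X₂ + X₂) + (Y₁ + C ∸ Y₂ + Y₂)     ≡⟨ cong₂ _+_ (m∸n+n≡m X₂≤) (m∸n+n≡m Y₂≤) ⟩
      (X₁ + C) + (Y₁ + C)                         ≡⟨ interchange X₁ C Y₁ C ⟩
      (X₁ + Y₁) + top c                           ∎

    classify : ∀ {X₁ Y₁ X₂ Y₂} → Region c ⟪ X₁ , Y₁ ⟫ → Region c ⟪ X₂ , Y₂ ⟫ →
               Shifted (X₁ + C ∸ X₂) (Y₁ + C ∸ Y₂)
    classify {X₁} {Y₁} {X₂} {Y₂} (region X₁≤ Y₁≤ g₁) (region X₂≤ Y₂≤ g₂)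
      with sum-of-difference (shifted-sum (≤-trans X₂≤ (m≤n+m C X₁)) (≤-trans Y₂≤ (m≤n+m C Y₁)))
                             (+-mono-≤ X₁≤ Y₁≤) g₁ g₂
    ... | inj₁ kept-sum = kept (shifted≤ {v = X₂} X₁≤) (shifted≤ {v = Y₂} Y₁≤) kept-sum
      where
      shifted≤ : ∀ {u v} → u ≤ C → u + C ∸ v ≤ top c
      shifted≤ {u} {v} u≤C = ≤-trans (m∸n≤m (u + C) v) (+-monoˡ-≤ C u≤C)
    ... | inj₂ (s₁≡top , s₂≤c) with x+y≡m+m⇒x≡m×y≡m X₁≤ Y₁≤ s₁≡top
    ...   | refl , refl = case-on X₂ Y₂ s₂≤c
      where
      case-on : ∀ x y → x + y ≤ c → Shifted (top c ∸ x) (top c ∸ y)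
      case-on zero    zero    _ = apex
      case-on zero    (suc y) h = corner zero (suc y) (s≤s z≤n) h
      case-on (suc x) y       h = corner (suc x) y (s≤s z≤n) h

    image : ∀ {a b} → Shifted a b → ℤ²
    image {a} {b} (kept _ _ _) = ⟪ a , b ⟫
    image apex                 = ⟪ 0 , suc c ⟫
    image (corner x y _ _)     = ⟪ suc c ∸ x , c ∸ y ⟫

    corner-x≤ : ∀ {x y} → x + y ≤ c → x ≤ c
    corner-x≤ {x} {y} x+y≤c = ≤-trans (m≤m+n x y) x+y≤c

    corner-y≤ : ∀ {x y} → x + y ≤ c → y ≤ c
    corner-y≤ {x} {y} x+y≤c = ≤-trans (m≤n+m y x) x+y≤c

    corner-sum : ∀ {x y} → x + y ≤ c → (suc c ∸ x) + (c ∸ y) + (x + y) ≡ suc c + c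
    corner-sum {x} {y} x+y≤c = trans (interchange (suc c ∸ x) (c ∸ y) x y)
      (cong₂ _+_ (m∸n+n≡m (m≤n⇒m≤1+n (corner-x≤ {x} x+y≤c))) (m∸n+n≡m (corner-y≤ {x} x+y≤c)))

    corner-sum-between : ∀ {x y} → 1 ≤ x + y → x + y ≤ c →
                         c < (suc c ∸ x) + (c ∸ y) × (suc c ∸ x) + (c ∸ y) ≤ c + c
    corner-sum-between {x} {y} 1≤x+y x+y≤c =
      +-cancelʳ-≤ (x + y) (suc c) σ (begin
        suc c + (x + y)  ≤⟨ +-monoʳ-≤ (suc c) x+y≤c ⟩
        suc c + c        ≡⟨ corner-sum {x} {y} x+y≤c ⟨
        σ + (x + y)      ∎) ,
      +-cancelʳ-≤ (x + y) σ (c + c) (begin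
        σ + (x + y)      ≡⟨ corner-sum {x} {y} x+y≤c ⟩
        suc c + c        ≡⟨ +-comm 1 (c + c) ⟩
        c + c + 1        ≤⟨ +-monoʳ-≤ (c + c) 1≤x+y ⟩
        c + c + (x + y)  ∎)
      where
      σ : ℕ
      σ = (suc c ∸ x) + (c ∸ y)

    not-kept : ∀ {σ} → c < σ → σ ≤ c + c → ¬ Kept σ
    not-kept c<σ _    (inj₁ σ≤c)     = <⇒≱ c<σ σ≤c
    not-kept _   σ≤2c (inj₂ (T≤σ , _)) = <⇒≱ (≤-<-trans σ≤2c c+c<T) T≤σ

    image-injective : ∀ {a b a′ b′} (s : Shifted a b) (s′ : Shifted a′ b′) → image s ≡ image s′ → a ≡ a′ × b ≡ b′
    image-injective (kept _ _ _) (kept _ _ _) eq = ⟪⟫-injective eq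
    image-injective (kept _ _ k) apex eq with ⟪⟫-injective eq
    ... | refl , refl = ⊥-elim (not-kept ≤-refl (+-monoˡ-≤ c 1≤c) k)
    image-injective (kept _ _ k) (corner x y 1≤ ≤c) eq with ⟪⟫-injective eq
    ... | refl , refl = ⊥-elim (uncurry not-kept (corner-sum-between {x} {y} 1≤ ≤c) k)
    image-injective apex (kept _ _ k) eq with ⟪⟫-injective eq
    ... | refl , refl = ⊥-elim (not-kept ≤-refl (+-monoˡ-≤ c 1≤c) k)
    image-injective apex apex _ = refl , refl
    image-injective apex (corner x y _ ≤c) eq =
      ⊥-elim (<⇒≱ (s≤s (corner-x≤ {x} ≤c)) (m∸n≡0⇒m≤n (sym (proj₁ (⟪⟫-injective eq)))))
    image-injective (corner x y 1≤ ≤c) (kept _ _ k) eq with ⟪⟫-injective eq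
    ... | refl , refl = ⊥-elim (uncurry not-kept (corner-sum-between {x} {y} 1≤ ≤c) k)
    image-injective (corner x y _ ≤c) apex eq =
      ⊥-elim (<⇒≱ (s≤s (corner-x≤ {x} ≤c)) (m∸n≡0⇒m≤n (proj₁ (⟪⟫-injective eq))))
    image-injective (corner x y _ ≤c) (corner x′ y′ _ ≤c′) eq with ⟪⟫-injective eq
    ... | eq₁ , eq₂ =
      cong (top c ∸_) (∸-cancelˡ-≡ (m≤n⇒m≤1+n (corner-x≤ {x} ≤c)) (m≤n⇒m≤1+n (corner-x≤ {x′} ≤c′)) eq₁) ,
      cong (top c ∸_) (∸-cancelˡ-≡ (corner-y≤ {x} ≤c) (corner-y≤ {x′} ≤c′) eq₂)

    small-Region : ∀ {u v} → u + v ≤ c + c → Region (c + c) ⟪ u , v ⟫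
    small-Region {u} {v} u+v≤ = region (box (≤-trans (m≤m+n u v) u+v≤)) (box (≤-trans (m≤n+m v u) u+v≤)) (inj₁ u+v≤)
      where
      box : ∀ {w} → w ≤ c + c → w ≤ (c + c) * n
      box w≤ = ≤-trans w≤ (c≤c*n (c + c))

    image∈Region : ∀ {a b} (s : Shifted a b) → Region (c + c) (image s)
    image∈Region (kept a≤ b≤ k) = region (double-box a≤) (double-box b≤) (kept⇒GoodSum k)
      where
      double-box : ∀ {u} → u ≤ top c → u ≤ (c + c) * n
      double-box {u} = subst (u ≤_) (sym (*-distribʳ-+ n c c))
      kept⇒GoodSum : ∀ {σ} → Kept σ → GoodSum (c + c) σ
      kept⇒GoodSum (inj₁ σ≤c) = inj₁ (≤-trans σ≤c (m≤m+n c c))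
      kept⇒GoodSum (inj₂ mid) = inj₂ (inj₁ mid)
    image∈Region apex = small-Region (+-monoˡ-≤ c 1≤c)
    image∈Region (corner x y 1≤ ≤c) = small-Region (proj₂ (corner-sum-between {x} {y} 1≤ ≤c))

    c<top : c < top c
    c<top = <-≤-trans c<T T≤top

    image≢top : ∀ {a b} (s : Shifted a b) → image s ≢ ⟪ top c , top c ⟫
    image≢top (kept _ _ (inj₁ σ≤c)) eq with ⟪⟫-injective eq
    ... | refl , refl = <⇒≱ (<-≤-trans c<top (m≤m+n (top c) (top c))) σ≤c
    image≢top (kept _ _ (inj₂ (_ , σ+T≤))) eq with ⟪⟫-injective eq
    ... | refl , refl = <⇒≱ 1≤T (+-cancelˡ-≤ (top c + top c) T 0
                          (subst (top c + top c + T ≤_) (trans (top-+ c c) (sym (+-identityʳ _))) σ+T≤))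
    image≢top apex eq = <⇒≢ (≤-<-trans z≤n c<top) (proj₁ (⟪⟫-injective eq))
    image≢top (corner x y _ _) eq = <⇒≢ (≤-<-trans (m∸n≤m c y) c<top) (proj₂ (⟪⟫-injective eq))

    difference-shift : ∀ {X₁ X₂} → X₂ ≤ X₁ + C → (ℤ.+ X₁ ℤ.- ℤ.+ X₂) ℤ.+ ℤ.+ C ≡ ℤ.+ (X₁ + C ∸ X₂)
    difference-shift {X₁} {X₂} X₂≤ =
      trans (sub-add (ℤ.+ X₁) (ℤ.+ X₂) (ℤ.+ C)) (trans (ℤ.m-n≡m⊖n (X₁ + C) X₂) (ℤ.⊖-≥ X₂≤))
      where
      sub-add : ∀ p q r → (p ℤ.- q) ℤ.+ r ≡ (p ℤ.+ r) ℤ.- q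
      sub-add = ℤ-Solver.solve-∀

    record Shift (z : ℤ²) : Set where
      constructor shift
      field
        {a b} : ℕ
        shape : Shifted a b
        z+C≡  : z +² ⟪ C , C ⟫ ≡ ⟪ a , b ⟫

    shift-of : ∀ {z} → z ∈ (c · A) ⊖ (c · A) → Shift z
    shift-of z∈ with ∈-cartesianProductWith⁻ _-²_ (c · A) (c · A) z∈
    ... | _ , _ , u∈ , v∈ , refl with ·A⊆Region c u∈ | ·A⊆Region c v∈
    ... | r₁@(region {X₁} {Y₁} _ _ _) | r₂@(region X₂≤ Y₂≤ _) =
      shift (classify r₁ r₂)
            (cong₂ _,_ (difference-shift (≤-trans X₂≤ (m≤n+m C X₁))) (difference-shift (≤-trans Y₂≤ (m≤n+m C Y₁))))

    shift-injective : ∀ {z z′} (σ : Shift z) (σ′ : Shift z′) →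
                      image (Shift.shape σ) ≡ image (Shift.shape σ′) → z ≡ z′
    shift-injective (shift s e) (shift s′ e′) eq with image-injective s s′ eq
    ... | refl , refl = +²-cancelʳ ⟪ C , C ⟫ (trans e (sym e′))

    fold : ∀ {z} → z ∈ (c · A) ⊖ (c · A) → ℤ²
    fold z∈ = image (Shift.shape (shift-of z∈))

    ∣⊖∣<∣⊕∣ : ∣ (c · A) ⊖ (c · A) ∣ < ∣ (c · A) ⊕ (c · A) ∣
    ∣⊖∣<∣⊕∣ = ∣∣<∣∣-by-injection fold
      (λ p q → shift-injective (shift-of p) (shift-of q))
      (λ p → ∈-·-+⁻ c c (Region⊆·A (c + c) (≤-trans 1≤c (m≤m+n c c)) (image∈Region (Shift.shape (shift-of p)))))
      ⟪ top c , top c ⟫ (∈-cartesianProductWith⁺ _+²_ (top∈· c) (top∈· c))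
      (λ p → image≢top (Shift.shape (shift-of p)))

corollary3p5 : (k : ℕ) → 1 ≤ k →
    Σ[ A ∈ List ℤ² ] ((c : ℕ) → 1 ≤ c → c ≤ k →
      ∣ (c · A) ⊖ (c · A) ∣ < ∣ (c · A) ⊕ (c · A) ∣)
corollary3p5 k _ = A , λ c 1≤c c≤k → Injection.∣⊖∣<∣⊕∣ c 1≤c (s≤s (+-mono-≤ c≤k c≤k))
  where
  open Construction (suc (k + k)) (s≤s z≤n)
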